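{- Let $n\ge 5$ be an integer and $K_{1,n-1}$ the star graph with $n$ vertices. Then every automorphism of $F_2(K_{1,n-1})$ is induced by an automorphism of $K_{1,n-1}$, i.e. $\mathrm{Aut}(F_2(K_{1,n-1}))=\mathrm{Aut}(K_{1,n-1})\cong S_{n-1}$.
   Context: For a graph $\Gamma$, the $2$-token graph $F_2(\Gamma)$ has as vertices all $2$-element subsets of $V(\Gamma)$, two being adjacent iff their symmetric difference is an edge of $\Gamma$. An automorphism $\theta$ of $\Gamma$ induces the automorphism $\{a,b\}\mapsto\{\theta(a),\theta(b)\}$ of $F_2(\Gamma)$; $\mathrm{Aut}(F_2(\Gamma))=\mathrm{Aut}(\Gamma)$ means every automorphism of $F_2(\Gamma)$ is of this form. The star $K_{1,n-1}$ has one vertex adjacent to all other $n-1$ vertices and no other edges. -}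

module Defs where

open import Data.Nat using (ℕ)
open import Data.Fin using (Fin; toℕ; _<_)
open import Data.Product using (Σ; _×_; _,_; proj₁; proj₂)
open import Data.Sum using (_⊎_)
open import Relation.Binary.PropositionalEquality using (_≡_)
open import Relation.Nullary using (¬_)
open import Function.Bundles using (_↔_; Inverse)

-- A simple graph on vertex type V: an adjacency relation (symmetric, irreflexive
-- where needed; we only use concrete graphs below).
Graph : Set → Set₁
Graph V = V → V → Set

record Aut {V : Set} (G : Graph V) : Set where
  field
    perm     : V ↔ V
  open Inverse perm public
  field
    preserves : ∀ x y → G x y → G (to x) (to y)
    reflects  : ∀ x y → G (to x) (to y) → G x y

Star : (n : ℕ) → Graph (Fin n)
Star n x y = ¬ (x ≡ y) × (toℕ x ≡ 0 ⊎ toℕ y ≡ 0)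

-- 2-element subsets of Fin n, represented canonically as ordered pairs a < b.
Pair2 : ℕ → Set
Pair2 n = Σ (Fin n × Fin n) λ ab → proj₁ ab < proj₂ ab

fst snd : ∀ {n} → Pair2 n → Fin n
fst ((a , _) , _) = a
snd ((_ , b) , _) = b

_∈₂_ : ∀ {n} → Fin n → Pair2 n → Set
x ∈₂ p = x ≡ fst p ⊎ x ≡ snd p

InExactlyOne : ∀ {n} → Fin n → Pair2 n → Pair2 n → Set
InExactlyOne x p q = (x ∈₂ p × ¬ (x ∈₂ q)) ⊎ (x ∈₂ q × ¬ (x ∈₂ p))

-- 2-token graph F₂(G): {a,b} ~ {c,d} iff their symmetric difference is an
-- edge {u,v} of G.
F₂ : ∀ {n} → Graph (Fin n) → Graph (Pair2 n)
F₂ {n} G p q = Σ (Fin n × Fin n) λ uv →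
    G (proj₁ uv) (proj₂ uv)
  × (∀ x → InExactlyOne x p q → (x ≡ proj₁ uv ⊎ x ≡ proj₂ uv))
  × (∀ x → (x ≡ proj₁ uv ⊎ x ≡ proj₂ uv) → InExactlyOne x p q)

-- θ induces on 2-subsets: φ{a,b} = {θ a, θ b}, stated as equality of sets.
SameSet : ∀ {n} → Pair2 n → Fin n → Fin n → Set
SameSet p x y = ∀ z → z ∈₂ p → (z ≡ x ⊎ z ≡ y)
                × ((z ≡ x ⊎ z ≡ y) → z ∈₂ p)

InducedBy : ∀ {n} {G : Graph (Fin n)} → Aut (F₂ G) → Aut G → Set
InducedBy φ θ = ∀ p → SameSet (Aut.to φ p) (Aut.to θ (fst p)) (Aut.to θ (snd p))

-- In F₂(K_{1,n-1}) a pair {a,b} of leaves has exactly two neighbours, {0,a} and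
-- {0,b}, whereas a pair {0,a} through the centre has the n-2 ≥ 3 neighbours
-- {a,j}.  Hence every automorphism φ maps centre pairs to centre pairs, and
-- θ(0) = 0, φ{0,a} = {0,θ(a)} defines a permutation fixing the centre, i.e. an
-- automorphism of the star.  A leaf pair {a,b} is adjacent to {0,a} and {0,b},
-- so φ{a,b} is a leaf pair adjacent to {0,θ(a)} and {0,θ(b)}, which forces
-- φ{a,b} = {θ(a),θ(b)}.
module Submission where

open import Defs
open import Data.Nat using (ℕ; suc; _≥_; _+_; s≤s; z≤n)
open import Data.Nat.Properties using (m≤n⇒∃[o]m+o≡n)
open import Data.Fin using (Fin; zero; suc; toℕ; punchIn)
open import Data.Fin.Properties
  using (_≟_; <-cmp; <-irrefl; <-irrelevant; toℕ-injective; suc-injective; punchIn-injective; punchInᵢ≢i)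
open import Data.Product using (Σ; _×_; _,_; proj₁; proj₂)
open import Data.Sum using (_⊎_; inj₁; inj₂; [_,_]; swap; map)
open import Data.Empty using (⊥; ⊥-elim)
open import Function using (_∘_; id)
open import Function.Bundles using (_↔_; Inverse; Injection; mk↔ₛ′)
open import Function.Properties.Inverse using (↔-sym; ↔⇒↣)
open import Relation.Binary.Definitions using (tri<; tri≈; tri>)
open import Relation.Binary.PropositionalEquality using (_≡_; _≢_; refl; sym; trans; cong; subst; subst₂)
open import Relation.Nullary using (¬_; Dec)
open import Relation.Nullary.Decidable using (_⊎-dec_; decidable-stable)

three-in-two : ∀ {A : Set} {x y z u v : A} → x ≢ y → x ≢ z → y ≢ z →
               x ≡ u ⊎ x ≡ v → y ≡ u ⊎ y ≡ v → z ≡ u ⊎ z ≡ v → ⊥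
three-in-two x≢y _ _ (inj₁ refl) (inj₁ refl) _ = x≢y refl
three-in-two x≢y _ _ (inj₂ refl) (inj₂ refl) _ = x≢y refl
three-in-two _ x≢z _ (inj₁ refl) _ (inj₁ refl) = x≢z refl
three-in-two _ x≢z _ (inj₂ refl) _ (inj₂ refl) = x≢z refl
three-in-two _ _ y≢z _ (inj₁ refl) (inj₁ refl) = y≢z refl
three-in-two _ _ y≢z _ (inj₂ refl) (inj₂ refl) = y≢z refl

module _ {V : Set} {G : Graph V} where

  Aut-inverse : Aut G → Aut G
  Aut-inverse ψ = record
    { perm      = ↔-sym perm
    ; preserves = λ x y g → reflects (from x) (from y)
        (subst₂ G (sym (strictlyInverseˡ x)) (sym (strictlyInverseˡ y)) g)
    ; reflects  = λ x y g → subst₂ G (strictlyInverseˡ x) (strictlyInverseˡ y)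
        (preserves (from x) (from y) g)
    }
    where open Aut ψ

  Aut-injective : (ψ : Aut G) → ∀ {x y} → Aut.to ψ x ≡ Aut.to ψ y → x ≡ y
  Aut-injective ψ = Injection.injective (↔⇒↣ (Aut.perm ψ))

record HasThreeNeighbours {V : Set} (G : Graph V) (x : V) : Set where
  field
    {y₁ y₂ y₃} : V
    adj₁  : G x y₁
    adj₂  : G x y₂
    adj₃  : G x y₃
    y₁≢y₂ : y₁ ≢ y₂
    y₁≢y₃ : y₁ ≢ y₃
    y₂≢y₃ : y₂ ≢ y₃

Aut-preserves-HasThreeNeighbours : ∀ {V} {G : Graph V} (ψ : Aut G) {x} →
  HasThreeNeighbours G x → HasThreeNeighbours G (Aut.to ψ x)
Aut-preserves-HasThreeNeighbours ψ {x} t = record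
  { adj₁  = preserves x _ adj₁
  ; adj₂  = preserves x _ adj₂
  ; adj₃  = preserves x _ adj₃
  ; y₁≢y₂ = y₁≢y₂ ∘ Aut-injective ψ
  ; y₁≢y₃ = y₁≢y₃ ∘ Aut-injective ψ
  ; y₂≢y₃ = y₂≢y₃ ∘ Aut-injective ψ
  }
  where
  open Aut ψ
  open HasThreeNeighbours t

module _ {n : ℕ} where

  Pair2-≡ : {p q : Pair2 n} → fst p ≡ fst q → snd p ≡ snd q → p ≡ q
  Pair2-≡ {(a , b) , a<b} {(.a , .b) , a<b′} refl refl
    rewrite <-irrelevant a<b a<b′ = refl

  fst≢snd : (p : Pair2 n) → fst p ≢ snd p
  fst≢snd ((a , .a) , a<a) refl = <-irrefl refl a<a

  _∈₂?_ : (x : Fin n) (p : Pair2 n) → Dec (x ∈₂ p)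
  x ∈₂? p = (x ≟ fst p) ⊎-dec (x ≟ snd p)

  Elements : Pair2 n → Fin n → Fin n → Set
  Elements p x y = ∀ z → (z ∈₂ p → z ≡ x ⊎ z ≡ y) × (z ≡ x ⊎ z ≡ y → z ∈₂ p)

  Elements-fst-snd : (p : Pair2 n) → Elements p (fst p) (snd p)
  Elements-fst-snd p z = id , id

  Elements-snd-fst : (p : Pair2 n) → Elements p (snd p) (fst p)
  Elements-snd-fst p z = swap , swap

  pairOf : (x y : Fin n) → x ≢ y → Σ (Pair2 n) λ p → Elements p x y
  pairOf x y x≢y with <-cmp x y
  ... | tri< x<y _ _ = ((x , y) , x<y) , Elements-fst-snd ((x , y) , x<y)
  ... | tri≈ _ x≡y _ = ⊥-elim (x≢y x≡y)
  ... | tri> _ _ y<x = ((y , x) , y<x) , Elements-snd-fst ((y , x) , y<x)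

  ∈₂-∈₂⇒SameSet : (p : Pair2 n) {x y : Fin n} → x ∈₂ p → y ∈₂ p → x ≢ y → SameSet p x y
  ∈₂-∈₂⇒SameSet p (inj₁ refl) (inj₂ refl) _ z z∈p = z∈p , λ _ → z∈p
  ∈₂-∈₂⇒SameSet p (inj₂ refl) (inj₁ refl) _ z z∈p = swap z∈p , λ _ → z∈p
  ∈₂-∈₂⇒SameSet p (inj₁ refl) (inj₁ refl) x≢y = ⊥-elim (x≢y refl)
  ∈₂-∈₂⇒SameSet p (inj₂ refl) (inj₂ refl) x≢y = ⊥-elim (x≢y refl)

  F₂-sym : {G : Graph (Fin n)} (p q : Pair2 n) → F₂ G p q → F₂ G q p
  F₂-sym _ _ (uv , edge , ⊆uv , uv⊆) = uv , edge , (λ x → ⊆uv x ∘ swap) , (λ x → swap ∘ uv⊆ x)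

module _ {m : ℕ} where

  Centred : Pair2 (suc m) → Set
  Centred p = fst p ≡ zero

  snd≢zero : (p : Pair2 (suc m)) → snd p ≢ zero
  snd≢zero ((_ , zero) , ())

  zero∉₂-nonCentred : (p : Pair2 (suc m)) → ¬ Centred p → ¬ (zero ∈₂ p)
  zero∉₂-nonCentred p p≢ (inj₁ e) = p≢ (sym e)
  zero∉₂-nonCentred p _  (inj₂ e) = snd≢zero p (sym e)

  star : Fin m → Pair2 (suc m)
  star y = (zero , suc y) , s≤s z≤n

  centred⇒star : (p : Pair2 (suc m)) → Centred p → Σ (Fin m) λ y → p ≡ star y
  centred⇒star ((zero , suc y) , s≤s z≤n) refl = y , refl

  centred-≡ : {p q : Pair2 (suc m)} → Centred p → Centred q → snd p ≡ snd q → p ≡ q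
  centred-≡ p₀ q₀ = Pair2-≡ (trans p₀ (sym q₀))

  Star-edge-centre : {u v : Fin (suc m)} → Star (suc m) u v → zero ≡ u ⊎ zero ≡ v
  Star-edge-centre (_ , inj₁ u₀) = inj₁ (sym (toℕ-injective u₀))
  Star-edge-centre (_ , inj₂ v₀) = inj₂ (sym (toℕ-injective v₀))

  -- The symmetric difference of {a,b} and {0,a} is the edge {b,0}.
  leafPair-adjacent-star : (p : Pair2 (suc m)) {a b : Fin m} →
    Elements p (suc a) (suc b) → a ≢ b → F₂ (Star (suc m)) p (star a)
  leafPair-adjacent-star p {a} {b} p≐ab a≢b = (suc b , zero) , ((λ ()) , inj₂ refl) , ⊆edge , edge⊆
    where
    ⊆edge : ∀ x → InExactlyOne x p (star a) → x ≡ suc b ⊎ x ≡ zero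
    ⊆edge x (inj₁ (x∈p , x∉star)) with proj₁ (p≐ab x) x∈p
    ... | inj₁ refl = ⊥-elim (x∉star (inj₂ refl))
    ... | inj₂ e    = inj₁ e
    ⊆edge x (inj₂ (inj₁ e , _))      = inj₂ e
    ⊆edge x (inj₂ (inj₂ refl , x∉p)) = ⊥-elim (x∉p (proj₂ (p≐ab x) (inj₁ refl)))
    edge⊆ : ∀ x → x ≡ suc b ⊎ x ≡ zero → InExactlyOne x p (star a)
    edge⊆ x (inj₁ refl) = inj₁ (proj₂ (p≐ab x) (inj₂ refl) , [ (λ ()) , a≢b ∘ sym ∘ suc-injective ])
    edge⊆ x (inj₂ refl) = inj₂ (inj₁ refl , [ (λ ()) , (λ ()) ] ∘ proj₁ (p≐ab zero))

  -- The edge of F₂ contains the centre, which lies in r but not in q; the other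
  -- endpoint is the only element of q that can be missing from r.
  nonCentred-neighbour : (q r : Pair2 (suc m)) → ¬ Centred q →
    F₂ (Star (suc m)) q r → Centred r × snd r ∈₂ q
  nonCentred-neighbour q r q≢ ((u , v) , edge , ⊆edge , edge⊆) = r₀ , snd-r∈q
    where
    zero∈edge : zero ≡ u ⊎ zero ≡ v
    zero∈edge = Star-edge-centre edge
    r₀ : Centred r
    r₀ with edge⊆ zero zero∈edge
    ... | inj₁ (zero∈q , _) = ⊥-elim (zero∉₂-nonCentred q q≢ zero∈q)
    ... | inj₂ (inj₁ e , _) = sym e
    ... | inj₂ (inj₂ e , _) = ⊥-elim (snd≢zero r (sym e))
    snd-r∈q : snd r ∈₂ q
    snd-r∈q = decidable-stable (snd r ∈₂? q) λ snd-r∉q →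
      three-in-two (fst≢snd q) q≢ (snd≢zero q)
        (⊆edge (fst q) (inj₁ (inj₁ refl ,
          [ (λ e → q≢ (trans e r₀)) , (λ e → snd-r∉q (inj₁ (sym e))) ])))
        (⊆edge (snd q) (inj₁ (inj₂ refl ,
          [ (λ e → snd≢zero q (trans e r₀)) , (λ e → snd-r∉q (inj₂ (sym e))) ])))
        zero∈edge

  nonCentred⇒¬HasThreeNeighbours : {q : Pair2 (suc m)} → ¬ Centred q →
    ¬ HasThreeNeighbours (F₂ (Star (suc m))) q
  nonCentred⇒¬HasThreeNeighbours {q} q≢ t =
    three-in-two (snd-distinct y₁ y₂ y₁≢y₂ adj₁ adj₂) (snd-distinct y₁ y₃ y₁≢y₃ adj₁ adj₃)
      (snd-distinct y₂ y₃ y₂≢y₃ adj₂ adj₃)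
      (snd∈q y₁ adj₁) (snd∈q y₂ adj₂) (snd∈q y₃ adj₃)
    where
    open HasThreeNeighbours t
    snd∈q : ∀ r → F₂ (Star (suc m)) q r → snd r ∈₂ q
    snd∈q r = proj₂ ∘ nonCentred-neighbour q r q≢
    snd-distinct : ∀ r r′ → r ≢ r′ → F₂ (Star (suc m)) q r → F₂ (Star (suc m)) q r′ → snd r ≢ snd r′
    snd-distinct r r′ r≢r′ adj adj′ = r≢r′ ∘ centred-≡ {r} {r′}
      (proj₁ (nonCentred-neighbour q r q≢ adj)) (proj₁ (nonCentred-neighbour q r′ q≢ adj′))

module _ {l : ℕ} where

  -- The neighbours {a,j} of {0,a} are indexed by j = punchIn a t, which
  -- enumerates the leaves other than a without repetition.
  starNeighbour : Fin (suc l) → Fin l → Pair2 (suc (suc l))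
  starNeighbour y t =
    proj₁ (pairOf (suc y) (suc (punchIn y t)) (punchInᵢ≢i y t ∘ sym ∘ suc-injective))

  starNeighbour-elements : (y : Fin (suc l)) (t : Fin l) →
    Elements (starNeighbour y t) (suc y) (suc (punchIn y t))
  starNeighbour-elements y t =
    proj₂ (pairOf (suc y) (suc (punchIn y t)) (punchInᵢ≢i y t ∘ sym ∘ suc-injective))

  star-adjacent-starNeighbour : (y : Fin (suc l)) (t : Fin l) →
    F₂ (Star (suc (suc l))) (star y) (starNeighbour y t)
  star-adjacent-starNeighbour y t =
    F₂-sym (starNeighbour y t) (star y)
      (leafPair-adjacent-star (starNeighbour y t) (starNeighbour-elements y t) (punchInᵢ≢i y t ∘ sym))

  starNeighbour-injective : (y : Fin (suc l)) {t t′ : Fin l} →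
    starNeighbour y t ≡ starNeighbour y t′ → t ≡ t′
  starNeighbour-injective y {t} {t′} e
    with proj₁ (starNeighbour-elements y t′ _)
           (subst (suc (punchIn y t) ∈₂_) e (proj₂ (starNeighbour-elements y t _) (inj₂ refl)))
  ... | inj₁ j≡y = ⊥-elim (punchInᵢ≢i y t (suc-injective j≡y))
  ... | inj₂ j≡j′ = punchIn-injective y t t′ (suc-injective j≡j′)

star-HasThreeNeighbours : ∀ {k} (y : Fin (4 + k)) → HasThreeNeighbours (F₂ (Star (5 + k))) (star y)
star-HasThreeNeighbours y = record
  { adj₁  = star-adjacent-starNeighbour y zero
  ; adj₂  = star-adjacent-starNeighbour y (suc zero)
  ; adj₃  = star-adjacent-starNeighbour y (suc (suc zero))
  ; y₁≢y₂ = (λ ()) ∘ starNeighbour-injective y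
  ; y₁≢y₃ = (λ ()) ∘ starNeighbour-injective y
  ; y₂≢y₃ = (λ ()) ∘ starNeighbour-injective y
  }

module _ {m : ℕ} where

  fixing-centre⇒Aut : (σ : Fin (suc m) ↔ Fin (suc m)) → Inverse.to σ zero ≡ zero →
    Aut (Star (suc m))
  fixing-centre⇒Aut σ σ0≡0 = record
    { perm      = σ
    ; preserves = λ x y (x≢y , centre) →
        x≢y ∘ injective , map (centre-preserved x) (centre-preserved y) centre
    ; reflects  = λ x y (σx≢σy , centre) →
        σx≢σy ∘ cong to , map (centre-reflected x) (centre-reflected y) centre
    }
    where
    open Inverse σ
    injective : ∀ {x y} → to x ≡ to y → x ≡ y
    injective = Injection.injective (↔⇒↣ σ)
    centre-preserved : ∀ x → toℕ x ≡ 0 → toℕ (to x) ≡ 0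
    centre-preserved x x₀ rewrite toℕ-injective {i = x} {j = zero} x₀ | σ0≡0 = refl
    centre-reflected : ∀ x → toℕ (to x) ≡ 0 → toℕ x ≡ 0
    centre-reflected x σx₀ = cong toℕ (injective (trans (toℕ-injective σx₀) (sym σ0≡0)))

module _ {k : ℕ} where

  Aut-preserves-Centred : (ψ : Aut (F₂ (Star (5 + k)))) (p : Pair2 (5 + k)) →
    Centred p → Centred (Aut.to ψ p)
  Aut-preserves-Centred ψ p p₀ with centred⇒star p p₀
  ... | y , refl = decidable-stable (fst (Aut.to ψ (star y)) ≟ zero) λ ψp≢ →
    nonCentred⇒¬HasThreeNeighbours ψp≢ (Aut-preserves-HasThreeNeighbours ψ (star-HasThreeNeighbours y))

  Aut-reflects-Centred : (ψ : Aut (F₂ (Star (5 + k)))) (p : Pair2 (5 + k)) →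
    Centred (Aut.to ψ p) → Centred p
  Aut-reflects-Centred ψ p ψp₀ =
    subst Centred (Aut.strictlyInverseʳ ψ p) (Aut-preserves-Centred (Aut-inverse ψ) (Aut.to ψ p) ψp₀)

  vertexMap : Aut (F₂ (Star (5 + k))) → Fin (5 + k) → Fin (5 + k)
  vertexMap ψ zero    = zero
  vertexMap ψ (suc y) = snd (Aut.to ψ (star y))

  vertexMap-inverse : (ψ χ : Aut (F₂ (Star (5 + k)))) → (∀ p → Aut.to χ (Aut.to ψ p) ≡ p) →
    ∀ x → vertexMap χ (vertexMap ψ x) ≡ x
  vertexMap-inverse ψ χ χψ≡id zero = refl
  vertexMap-inverse ψ χ χψ≡id (suc y)
    with Aut.to ψ (star y) | Aut-preserves-Centred ψ (star y) refl | χψ≡id (star y)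
  ... | q | q₀ | χq≡star-y with centred⇒star q q₀
  ... | _ , refl = cong snd χq≡star-y

  vertexMap-∈₂ : (ψ : Aut (F₂ (Star (5 + k)))) (p : Pair2 (5 + k)) {a b : Fin (4 + k)} →
    Elements p (suc a) (suc b) → a ≢ b → vertexMap ψ (suc a) ∈₂ Aut.to ψ p
  vertexMap-∈₂ ψ p {a} p≐ab a≢b =
    proj₂ (nonCentred-neighbour (to p) (to (star a)) (p≢ ∘ Aut-reflects-Centred ψ p)
      (preserves p (star a) (leafPair-adjacent-star p p≐ab a≢b)))
    where
    open Aut ψ
    p≢ : ¬ Centred p
    p≢ p₀ = [ (λ ()) , (λ ()) ] (proj₁ (p≐ab zero) (inj₁ (sym p₀)))

  vertexAut : Aut (F₂ (Star (5 + k))) → Aut (Star (5 + k))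
  vertexAut φ = fixing-centre⇒Aut
    (mk↔ₛ′ (vertexMap φ) (vertexMap φ⁻¹)
      (vertexMap-inverse φ⁻¹ φ (Aut.strictlyInverseˡ φ))
      (vertexMap-inverse φ φ⁻¹ (Aut.strictlyInverseʳ φ)))
    refl
    where
    φ⁻¹ : Aut (F₂ (Star (5 + k)))
    φ⁻¹ = Aut-inverse φ

  vertexAut-induces : (φ : Aut (F₂ (Star (5 + k)))) → InducedBy φ (vertexAut φ)
  vertexAut-induces φ ((zero , zero) , ())
  vertexAut-induces φ ((suc _ , zero) , ())
  vertexAut-induces φ ((zero , suc y) , s≤s z≤n) =
    ∈₂-∈₂⇒SameSet (Aut.to φ (star y)) (inj₁ (sym (Aut-preserves-Centred φ (star y) refl))) (inj₂ refl)
      (snd≢zero (Aut.to φ (star y)) ∘ sym)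
  vertexAut-induces φ p@((suc a , suc b) , _) =
    ∈₂-∈₂⇒SameSet (Aut.to φ p)
      (vertexMap-∈₂ φ p (Elements-fst-snd p) a≢b)
      (vertexMap-∈₂ φ p (Elements-snd-fst p) (a≢b ∘ sym))
      (a≢b ∘ suc-injective ∘ Aut-injective (vertexAut φ))
    where
    a≢b : a ≢ b
    a≢b = fst≢snd p ∘ cong suc

mainTheorem8 : (n : ℕ) → n ≥ 5 → (φ : Aut (F₂ (Star n))) →
    Σ (Aut (Star n)) (λ θ → InducedBy φ θ)
mainTheorem8 n n≥5 φ with m≤n⇒∃[o]m+o≡n n≥5
... | k , refl = vertexAut φ , vertexAut-induces φ
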